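{- Assume $S$ is normal and $C$ is an odd cycle of $G$ with $k$ vertices; let $\mathbf 1_C=\sum_{x_i\in V(C)}e_i$. (1) If $w=(\tilde w,a)=w'+(\mathbf 1_C,\frac{k+1}{2})$ with $w'\in\mathbb{N}B$ and $\tilde w\cdot e_i>0$ for every $1\le i\le n$, then $x^{\tilde w}t^a\in\omega_S$. Furthermore, if $\omega_S=(x^{\mathbf 1}t^b)$, then $w-(\mathbf 1,b)\in\mathbb{N}B$. (2) If $\omega_S=(x^{\mathbf 1}t^{\frac{n+1}{2}})$ and $(\mathbf 1+e_j,\frac{n+1}{2})\in\mathbb{N}B$, then there is an edge $y\in E(G)$ with $x_j\in y$ and $y\cap V(C)\neq\emptyset$.
   Context: $G$ is a connected simple graph with $V(G)=\{x_1,\dots,x_n\}$, $E(G)=\{y_1,\dots,y_q\}\neq\emptyset$; $e_1,\dots,e_n$ is the canonical basis of $\mathbb{R}^n$, $\mathbf 1=(1,\dots,1)\in\mathbb{R}^n$, $x^{\mathbf 1}=x_1\cdots x_n$, $v_k=e_i+e_j$ the characteristic vector of $y_k=\{x_i,x_j\}$; $S=K[x_1t,\dots,x_nt,x^{v_1}t,\dots,x^{v_q}t,t]\subset K[x_1,\dots,x_n][t]$ for a field $K$. Let $e_{n+1}=(0,\dots,0,1)$, $B=\{(e_1,1),\dots,(e_n,1),(v_1,1),\dots,(v_q,1),e_{n+1}\}$, $\mathbb{N}B$, $\mathbb{R}_+B$ its nonnegative integer and real combinations, $(\mathbb{R}_+B)^\circ$ the interior of $\mathbb{R}_+B$ in $\mathbb{R}^{n+1}$.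 When $S$ is normal its canonical module is the ideal $\omega_S$ of $S$ generated by the monomials $x^at^b$ with $(a,b)\in\mathbb{N}B\cap(\mathbb{R}_+B)^\circ$. -}

module Defs where

open import Data.Nat as ℕ using (ℕ; zero; suc; _≤_; _<_)
open import Data.Nat.DivMod using (_%_; m%n<n)
open import Data.Fin as Fin using (Fin; toℕ; fromℕ<)
open import Data.Vec as Vec using (Vec; zipWith; replicate; _[_]≔_; lookup)
import Data.List as List
open import Data.Product using (Σ; ∃; ∃-syntax; _×_; _,_; proj₁; proj₂)
open import Data.Sum using (_⊎_)
open import Data.Integer using (+_)
open import Data.Rational as ℚ using (ℚ; 0ℚ)
open import Function using (_⇔_)
open import Function.Definitions using (Injective)
open import Relation.Binary.PropositionalEquality using (_≡_)
open import Relation.Binary.Construct.Closure.ReflexiveTransitive using (Star)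
open import Relation.Nullary using (¬_)

record SimpleGraph (n : ℕ) : Set₁ where
  field
    Adj   : Fin n → Fin n → Set
    sym   : ∀ {i j} → Adj i j → Adj j i
    irrefl : ∀ {i} → ¬ Adj i i

module _ {n : ℕ} (G : SimpleGraph n) where
  open SimpleGraph G

  Connected : Set
  Connected = ∀ i j → Star Adj i j

  EdgesNonempty : Set
  EdgesNonempty = ∃[ i ] ∃[ j ] Adj i j

next : ∀ {k} → Fin k → Fin k
next {suc k} i = fromℕ< (m%n<n (suc (toℕ i)) (suc k))

record Cycle {n : ℕ} (G : SimpleGraph n) (k : ℕ) : Set where
  field
    3≤k : 3 ≤ k
    vtx : Fin k → Fin n
    inj : Injective _≡_ _≡_ vtx
    adj : ∀ i → SimpleGraph.Adj G (vtx i) (vtx (next i))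

_∈V_ : ∀ {n} {G : SimpleGraph n} {k} → Fin n → Cycle G k → Set
x ∈V C = ∃[ i ] Cycle.vtx C i ≡ x

-- Exponent vectors in ℕ^{n+1}, written as pairs (ã , a) ∈ ℕ^n × ℕ

Exp : ℕ → Set
Exp n = Vec ℕ n × ℕ

infixl 6 _⊕_
_⊕_ : ∀ {n} → Exp n → Exp n → Exp n
(u , a) ⊕ (v , b) = zipWith ℕ._+_ u v , a ℕ.+ b

e : ∀ {n} → Fin n → Vec ℕ n
e i = replicate _ 0 [ i ]≔ 1

𝟎 : ∀ {n} → Vec ℕ n
𝟎 = replicate _ 0

𝟏 : ∀ {n} → Vec ℕ n
𝟏 = replicate _ 1

_+ᵥ_ : ∀ {n} → Vec ℕ n → Vec ℕ n → Vec ℕ n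
_+ᵥ_ = zipWith ℕ._+_

vsum : ∀ {n} → List.List (Vec ℕ n) → Vec ℕ n
vsum = List.foldr _+ᵥ_ 𝟎

𝟏[_] : ∀ {n} {G : SimpleGraph n} {k} → Cycle G k → Vec ℕ n
𝟏[_] {k = k} C = vsum (List.map (λ i → e (Cycle.vtx C i)) (List.allFin k))

module _ {n : ℕ} (G : SimpleGraph n) where
  open SimpleGraph G

  data Gen : Exp n → Set where
    var  : ∀ i → Gen (e i , 1)
    edge : ∀ i j → Adj i j → Gen (e i +ᵥ e j , 1)
    tvar : Gen (𝟎 , 1)

  data ℕB : Exp n → Set where
    nil  : ℕB (𝟎 , 0)
    cons : ∀ {u g} → ℕB u → Gen g → ℕB (u ⊕ g)

  -- ℤB ∩ ℕ^{n+1}: differences of elements of ℕB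
  ℤB : Exp n → Set
  ℤB p = ∃[ u ] ∃[ v ] ℕB u × ℕB v × (p ⊕ v ≡ u)

  ExpQ : Set
  ExpQ = Vec ℚ n × ℚ

  embed : Exp n → ExpQ
  embed (u , a) = Vec.map (λ m → + m ℚ./ 1) u , + a ℚ./ 1

  _⊕q_ : ExpQ → ExpQ → ExpQ
  (u , a) ⊕q (v , b) = zipWith ℚ._+_ u v , a ℚ.+ b

  _·q_ : ℚ → ExpQ → ExpQ
  λ′ ·q (u , a) = Vec.map (λ′ ℚ.*_) u , λ′ ℚ.* a

  -- ℝ₊B ∩ ℚ^{n+1}: nonnegative (rational) combinations of B
  data Cone : ExpQ → Set where
    nil  : Cone (Vec.replicate n 0ℚ , 0ℚ)
    cons : ∀ {u g} (λ′ : ℚ) → ℚ.0ℚ ℚ.≤ λ′ → Cone u → Gen g → Cone (u ⊕q (λ′ ·q embed g))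

  -- interior of the cone (sup-norm balls, tested on rational points)
  Interior : ExpQ → Set
  Interior (p , a) = ∃[ ε ] (0ℚ ℚ.< ε) ×
    (∀ (q : Vec ℚ n) (b : ℚ) →
       (∀ i → ℚ.∣ lookup q i ℚ.- lookup p i ∣ ℚ.< ε) →
       ℚ.∣ b ℚ.- a ∣ ℚ.< ε → Cone (q , b))

  -- S normal  ⇔  ℕB = ℤB ∩ ℝ₊B  (Hochster)
  IsNormal : Set
  IsNormal = ∀ p → ℤB p → Cone (embed p) → ℕB p

  -- generators of ω_S: exponents in ℕB ∩ (ℝ₊B)°
  ωGen : Exp n → Set
  ωGen p = ℕB p × Interior (embed p)

  -- x^ã t^a ∈ ω_S  (ω_S is the monomial ideal of S generated by ωGen)
  Inω : Exp n → Set
  Inω p = ∃[ g ] ∃[ u ] ωGen g × ℕB u × (p ≡ g ⊕ u)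

  -- ω_S = (x^𝟏 t^b) as ideals of S (both are monomial ideals, so
  -- equality means they contain the same monomials)
  ωPrincipal : ℕ → Set
  ωPrincipal b = ∀ p → Inω p ⇔ (∃[ u ] ℕB u × (p ≡ (𝟏 , b) ⊕ u))

{-# OPTIONS --safe #-}
module Submission where

-- The k edges of C sum to (2·𝟏_C , k), so
-- y = 2w − e_{n+1} = 2w′ + (2·𝟏_C , k) lies in ℕB and w = (y + e_{n+1}) / 2. Because every
-- coordinate of w̃ is positive, each point near w is a slightly smaller multiple of y plus a
-- nonnegative combination of the (e_i , 1) and e_{n+1}; so w is interior. Also
-- w − (0 , m) = w′ + (𝟏_C , k) ∈ ℕB, so w ∈ ℤB, and normality gives w ∈ ℕB ∩ (ℝ₊B)°.
-- For (2), apply (1) to w′ = (𝟏 + e_j , b): as ω_S = (x^𝟏 t^b), u = w − (𝟏 , b) = (e_j + 𝟏_C , m + 1)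
-- lies in ℕB. Every g ∈ B has |g̃| ≤ 2 g_t, with equality only for edges; as |ũ| = k + 1 = 2 u_t,
-- u is a sum of edges, and the edge at x_j in this sum ends at some x_l ≠ x_j in the support of
-- u, that is, in V(C).

open import Defs
open import Algebra.Bundles using (CommutativeRing)
import Algebra.Properties.Semiring.Sum as SemiringSum
open import Data.Fin as Fin using (Fin; zero; suc; inject₁; toℕ)
import Data.Fin.Properties as FinP
import Data.Integer as ℤ
import Data.Integer.Properties as ℤ
import Data.List as List
import Data.List.Properties as List
open import Data.Nat as ℕ using (ℕ; zero; suc)
open import Data.Nat.DivMod using (_%_; n%n≡0; m<n⇒m%n≡m)
import Data.Nat.Properties as ℕP
open import Data.Nat.Tactic.RingSolver using (solve-∀)
open import Data.Product using (∃-syntax; _×_; _,_; proj₁; proj₂)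
open import Data.Rational
  using (ℚ; 0ℚ; 1ℚ; ∣_∣; _/_; 1/_; toℚᵘ; Positive; NonNegative; NonZero; nonNegative)
import Data.Rational.Properties as ℚP
open import Data.Rational.Solver using (module +-*-Solver)
import Data.Rational.Unnormalised as ℚᵘ
import Data.Rational.Unnormalised.Properties as ℚᵘ
open import Data.Sum using (_⊎_; inj₁; inj₂)
open import Data.Vec as Vec using (Vec; lookup; replicate; tabulate)
import Data.Vec.Properties as Vec
open import Data.Vec.Relation.Binary.Pointwise.Extensional using (ext; Pointwise-≡⇒≡)
open import Function using (_∘_; id; Equivalence)
open import Relation.Binary.PropositionalEquality
open import Relation.Nullary using (yes; no; contradiction)

module ℕΣ = SemiringSum ℕP.+-*-semiring
module ℚΣ = SemiringSum (CommutativeRing.semiring ℚP.+-*-commutativeRing)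

vec-ext : ∀ {a} {A : Set a} {m} {u v : Vec A m} → (∀ i → lookup u i ≡ lookup v i) → u ≡ v
vec-ext u≗v = Pointwise-≡⇒≡ (ext u≗v)

module _ where
  open import Data.Rational using (_+_; _*_; _-_; -_; _≤_; _<_)

  open +-*-Solver using (solve; _:+_; _:*_; :-_; _:-_; con; _:=_)

  fromℕ : ℕ → ℚ
  fromℕ m = ℤ.+ m / 1

  toℚᵘ-fromℕ : ∀ m → toℚᵘ (fromℕ m) ℚᵘ.≃ ℚᵘ.mkℚᵘ (ℤ.+ m) 0
  toℚᵘ-fromℕ m = ℚP.toℚᵘ-fromℚᵘ (ℚᵘ.mkℚᵘ (ℤ.+ m) 0)

  fromℕ-+ : ∀ m n → fromℕ (m ℕ.+ n) ≡ fromℕ m + fromℕ n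
  fromℕ-+ m n = ℚP.toℚᵘ-injective (begin-equality
    toℚᵘ (fromℕ (m ℕ.+ n))
      ≃⟨ toℚᵘ-fromℕ (m ℕ.+ n) ⟩
    ℚᵘ.mkℚᵘ (ℤ.+ (m ℕ.+ n)) 0
      ≃⟨ ℚᵘ.*≡* (cong (ℤ._* ℤ.+ 1) +[m+n]≡m+n) ⟩
    ℚᵘ.mkℚᵘ (ℤ.+ m) 0 ℚᵘ.+ ℚᵘ.mkℚᵘ (ℤ.+ n) 0
      ≃⟨ ℚᵘ.+-cong (toℚᵘ-fromℕ m) (toℚᵘ-fromℕ n) ⟨
    toℚᵘ (fromℕ m) ℚᵘ.+ toℚᵘ (fromℕ n)
      ≃⟨ ℚP.toℚᵘ-homo-+ (fromℕ m) (fromℕ n) ⟨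
    toℚᵘ (fromℕ m + fromℕ n) ∎)
    where
    open ℚᵘ.≤-Reasoning
    +[m+n]≡m+n : ℤ.+ (m ℕ.+ n) ≡ ℤ.+ m ℤ.* ℤ.+ 1 ℤ.+ ℤ.+ n ℤ.* ℤ.+ 1
    +[m+n]≡m+n = trans (ℤ.pos-+ m n) (sym (cong₂ ℤ._+_ (ℤ.*-identityʳ (ℤ.+ m)) (ℤ.*-identityʳ (ℤ.+ n))))

  fromℕ-* : ∀ m n → fromℕ (m ℕ.* n) ≡ fromℕ m * fromℕ n
  fromℕ-* m n = ℚP.toℚᵘ-injective (begin-equality
    toℚᵘ (fromℕ (m ℕ.* n))
      ≃⟨ toℚᵘ-fromℕ (m ℕ.* n) ⟩
    ℚᵘ.mkℚᵘ (ℤ.+ (m ℕ.* n)) 0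
      ≃⟨ ℚᵘ.*≡* (cong (ℤ._* ℤ.+ 1) (ℤ.pos-* m n)) ⟩
    ℚᵘ.mkℚᵘ (ℤ.+ m) 0 ℚᵘ.* ℚᵘ.mkℚᵘ (ℤ.+ n) 0
      ≃⟨ ℚᵘ.*-cong (toℚᵘ-fromℕ m) (toℚᵘ-fromℕ n) ⟨
    toℚᵘ (fromℕ m) ℚᵘ.* toℚᵘ (fromℕ n)
      ≃⟨ ℚP.toℚᵘ-homo-* (fromℕ m) (fromℕ n) ⟨
    toℚᵘ (fromℕ m * fromℕ n) ∎)
    where open ℚᵘ.≤-Reasoning

  fromℕ-suc : ∀ m → fromℕ (suc m) ≡ 1ℚ + fromℕ m
  fromℕ-suc = fromℕ-+ 1

  fromℕ-sum : ∀ {k} (f : Fin k → ℕ) → fromℕ (ℕΣ.sum f) ≡ ℚΣ.sum (fromℕ ∘ f)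
  fromℕ-sum {zero}  f = refl
  fromℕ-sum {suc k} f = trans (fromℕ-+ (f zero) _) (cong (fromℕ (f zero) +_) (fromℕ-sum (f ∘ suc)))

  fromℕ-nonNeg : ∀ m → 0ℚ ≤ fromℕ m
  fromℕ-nonNeg m = ℚP.nonNegative⁻¹ (fromℕ m) {{ℚP.normalize-nonNeg m 1}}

  fromℕ-suc-positive : ∀ m → Positive (fromℕ (suc m))
  fromℕ-suc-positive m = ℚP.normalize-pos (suc m) 1

  fromℕ-mono-≤ : ∀ {m n} → m ℕ.≤ n → fromℕ m ≤ fromℕ n
  fromℕ-mono-≤ {m} m≤n with ℕP.m≤n⇒∃[o]m+o≡n m≤n
  ... | o , refl = begin
    fromℕ m              ≡⟨ ℚP.+-identityʳ (fromℕ m) ⟨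
    fromℕ m + 0ℚ         ≤⟨ ℚP.+-monoʳ-≤ (fromℕ m) (fromℕ-nonNeg o) ⟩
    fromℕ m + fromℕ o    ≡⟨ fromℕ-+ m o ⟨
    fromℕ (m ℕ.+ o)      ∎
    where open ℚP.≤-Reasoning

  ℚsum-mono-≤ : ∀ {k} {f g : Fin k → ℚ} → (∀ i → f i ≤ g i) → ℚΣ.sum f ≤ ℚΣ.sum g
  ℚsum-mono-≤ {zero}  f≤g = ℚP.≤-refl
  ℚsum-mono-≤ {suc k} f≤g = ℚP.+-mono-≤ (f≤g zero) (ℚsum-mono-≤ (f≤g ∘ suc))

  ∑-δ : ∀ {k} (f : Fin k → ℚ) j → ℚΣ.sum (λ i → f i * fromℕ (lookup (e i) j)) ≡ f j
  ∑-δ {suc k} f zero = begin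
    f zero * 1ℚ + ℚΣ.sum (λ i → f (suc i) * 0ℚ)
      ≡⟨ cong₂ _+_ (ℚP.*-identityʳ (f zero)) (ℚΣ.sum-cong-≗ {k} (ℚP.*-zeroʳ ∘ f ∘ suc)) ⟩
    f zero + ℚΣ.sum {k} (λ _ → 0ℚ)
      ≡⟨ cong (f zero +_) (ℚΣ.sum-replicate-zero k) ⟩
    f zero + 0ℚ
      ≡⟨ ℚP.+-identityʳ (f zero) ⟩
    f zero ∎
    where open ≡-Reasoning
  ∑-δ {suc k} f (suc j) = begin
    f zero * fromℕ (lookup (replicate k 0) j) + ℚΣ.sum (λ i → f (suc i) * fromℕ (lookup (e i) j))
      ≡⟨ cong₂ _+_ (cong (λ x → f zero * fromℕ x) (Vec.lookup-replicate j 0)) (∑-δ (f ∘ suc) j) ⟩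
    f zero * 0ℚ + f (suc j)
      ≡⟨ cong (_+ f (suc j)) (ℚP.*-zeroʳ (f zero)) ⟩
    0ℚ + f (suc j)
      ≡⟨ ℚP.+-identityˡ (f (suc j)) ⟩
    f (suc j) ∎
    where open ≡-Reasoning

  p≤∣p∣ : ∀ p → p ≤ ∣ p ∣
  p≤∣p∣ p with ℚP.≤-total 0ℚ p
  ... | inj₁ 0≤p = ℚP.≤-reflexive (sym (ℚP.0≤p⇒∣p∣≡p 0≤p))
  ... | inj₂ p≤0 = ℚP.≤-trans p≤0 (ℚP.0≤∣p∣ p)

  ∣p∣<q⇒p≤q : ∀ {p q} → ∣ p ∣ < q → p ≤ q
  ∣p∣<q⇒p≤q {p} ∣p∣<q = ℚP.<⇒≤ (ℚP.≤-<-trans (p≤∣p∣ p) ∣p∣<q)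

  ∣p∣<q⇒-q≤p : ∀ {p q} → ∣ p ∣ < q → - q ≤ p
  ∣p∣<q⇒-q≤p {p} {q} ∣p∣<q = begin
    - q       ≤⟨ ℚP.neg-antimono-≤ (∣p∣<q⇒p≤q (subst (_< q) (sym (ℚP.∣-p∣≡∣p∣ p)) ∣p∣<q)) ⟩
    - (- p)   ≡⟨ neg-involutive p ⟩
    p         ∎
    where
    open ℚP.≤-Reasoning
    neg-involutive : ∀ x → - (- x) ≡ x
    neg-involutive = solve 1 (λ x → :- (:- x) := x) refl

  p≤q⇒0≤q-p : ∀ {p q} → p ≤ q → 0ℚ ≤ q - p
  p≤q⇒0≤q-p {p} {q} p≤q = begin
    0ℚ      ≡⟨ ℚP.+-inverseʳ p ⟨
    p - p   ≤⟨ ℚP.+-monoˡ-≤ (- p) p≤q ⟩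
    q - p   ∎
    where open ℚP.≤-Reasoning

  module _ {n : ℕ} (G : SimpleGraph n) where

    infixl 6 _⊞_
    infixr 7 _⊛_

    _⊞_ : ExpQ G → ExpQ G → ExpQ G
    _⊞_ = _⊕q_ G

    _⊛_ : ℚ → ExpQ G → ExpQ G
    _⊛_ = _·q_ G

    𝟘 : ExpQ G
    𝟘 = replicate n 0ℚ , 0ℚ

    lookup-⊞ : ∀ P R j → lookup (proj₁ (P ⊞ R)) j ≡ lookup (proj₁ P) j + lookup (proj₁ R) j
    lookup-⊞ P R j = Vec.lookup-zipWith _+_ j (proj₁ P) (proj₁ R)

    lookup-⊛-embed : ∀ c (u : Exp n) j → lookup (proj₁ (c ⊛ embed G u)) j ≡ c * fromℕ (lookup (proj₁ u) j)
    lookup-⊛-embed c u j =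
      trans (Vec.lookup-map j (c *_) (Vec.map fromℕ (proj₁ u))) (cong (c *_) (Vec.lookup-map j fromℕ (proj₁ u)))

    ⊞-identityˡ : ∀ P → 𝟘 ⊞ P ≡ P
    ⊞-identityˡ P = cong₂ _,_ (Vec.zipWith-identityˡ ℚP.+-identityˡ (proj₁ P)) (ℚP.+-identityˡ (proj₂ P))

    ⊞-identityʳ : ∀ P → P ⊞ 𝟘 ≡ P
    ⊞-identityʳ P = cong₂ _,_ (Vec.zipWith-identityʳ ℚP.+-identityʳ (proj₁ P)) (ℚP.+-identityʳ (proj₂ P))

    ⊞-assoc : ∀ P Q R → (P ⊞ Q) ⊞ R ≡ P ⊞ (Q ⊞ R)
    ⊞-assoc P Q R =
      cong₂ _,_ (Vec.zipWith-assoc ℚP.+-assoc (proj₁ P) (proj₁ Q) (proj₁ R))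
                (ℚP.+-assoc (proj₂ P) (proj₂ Q) (proj₂ R))

    ⊛-embed-𝟎 : ∀ c → c ⊛ embed G (𝟎 , 0) ≡ 𝟘
    ⊛-embed-𝟎 c = cong₂ _,_ (vec-ext (λ j → trans (lookup-⊛-embed c (𝟎 , 0) j) c*0≡0)) (ℚP.*-zeroʳ c)
      where
      c*0≡0 : ∀ {j} → c * fromℕ (lookup 𝟎 j) ≡ lookup (replicate n 0ℚ) j
      c*0≡0 {j} rewrite Vec.lookup-replicate j 0 | Vec.lookup-replicate j 0ℚ = ℚP.*-zeroʳ c

    ⊛-embed-⊕ : ∀ c (u v : Exp n) → c ⊛ embed G (u ⊕ v) ≡ c ⊛ embed G u ⊞ c ⊛ embed G v
    ⊛-embed-⊕ c u v = cong₂ _,_ (vec-ext coordinate) (linear (proj₂ u) (proj₂ v))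
      where
      linear : ∀ x y → c * fromℕ (x ℕ.+ y) ≡ c * fromℕ x + c * fromℕ y
      linear x y = trans (cong (c *_) (fromℕ-+ x y)) (ℚP.*-distribˡ-+ c (fromℕ x) (fromℕ y))
      coordinate : ∀ j →
        lookup (proj₁ (c ⊛ embed G (u ⊕ v))) j ≡ lookup (proj₁ (c ⊛ embed G u ⊞ c ⊛ embed G v)) j
      coordinate j = begin
        lookup (proj₁ (c ⊛ embed G (u ⊕ v))) j
          ≡⟨ lookup-⊛-embed c (u ⊕ v) j ⟩
        c * fromℕ (lookup (proj₁ u +ᵥ proj₁ v) j)
          ≡⟨ cong (λ x → c * fromℕ x) (Vec.lookup-zipWith ℕ._+_ j (proj₁ u) (proj₁ v)) ⟩
        c * fromℕ (lookup (proj₁ u) j ℕ.+ lookup (proj₁ v) j)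
          ≡⟨ linear (lookup (proj₁ u) j) (lookup (proj₁ v) j) ⟩
        c * fromℕ (lookup (proj₁ u) j) + c * fromℕ (lookup (proj₁ v) j)
          ≡⟨ cong₂ _+_ (lookup-⊛-embed c u j) (lookup-⊛-embed c v j) ⟨
        lookup (proj₁ (c ⊛ embed G u)) j + lookup (proj₁ (c ⊛ embed G v)) j
          ≡⟨ lookup-⊞ (c ⊛ embed G u) (c ⊛ embed G v) j ⟨
        lookup (proj₁ (c ⊛ embed G u ⊞ c ⊛ embed G v)) j ∎
        where open ≡-Reasoning

    cone-⊞ : ∀ {P R} → Cone G P → Cone G R → Cone G (P ⊞ R)
    cone-⊞ {P} P∈cone nil = subst (Cone G) (sym (⊞-identityʳ P)) P∈cone
    cone-⊞ {P} P∈cone (cons {u} {g} c 0≤c u∈cone g∈B) =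
      subst (Cone G) (⊞-assoc P u (c ⊛ embed G g)) (cons c 0≤c (cone-⊞ P∈cone u∈cone) g∈B)

    cone-generator : ∀ {c g} → 0ℚ ≤ c → Gen G g → Cone G (c ⊛ embed G g)
    cone-generator {c} {g} 0≤c g∈B = subst (Cone G) (⊞-identityˡ (c ⊛ embed G g)) (cons c 0≤c nil g∈B)

    cone-⊛-ℕB : ∀ {c u} → 0ℚ ≤ c → ℕB G u → Cone G (c ⊛ embed G u)
    cone-⊛-ℕB {c} 0≤c nil = subst (Cone G) (sym (⊛-embed-𝟎 c)) nil
    cone-⊛-ℕB {c} 0≤c (cons {u} {g} u∈ℕB g∈B) =
      subst (Cone G) (sym (⊛-embed-⊕ c u g)) (cons c 0≤c (cone-⊛-ℕB 0≤c u∈ℕB) g∈B)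

    ∑⊞ : ∀ {k} → (Fin k → ExpQ G) → ExpQ G
    ∑⊞ {zero}  F = 𝟘
    ∑⊞ {suc k} F = F zero ⊞ ∑⊞ (F ∘ suc)

    cone-∑⊞ : ∀ {k} {F : Fin k → ExpQ G} → (∀ i → Cone G (F i)) → Cone G (∑⊞ F)
    cone-∑⊞ {zero}  _     = nil
    cone-∑⊞ {suc k} F∈cone = cone-⊞ (F∈cone zero) (cone-∑⊞ (F∈cone ∘ suc))

    lookup-∑⊞ : ∀ {k} (F : Fin k → ExpQ G) j →
      lookup (proj₁ (∑⊞ F)) j ≡ ℚΣ.sum (λ i → lookup (proj₁ (F i)) j)
    lookup-∑⊞ {zero}  F j = Vec.lookup-replicate j 0ℚ
    lookup-∑⊞ {suc k} F j =
      trans (lookup-⊞ (F zero) (∑⊞ (F ∘ suc)) j) (cong (lookup (proj₁ (F zero)) j +_) (lookup-∑⊞ (F ∘ suc) j))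

    proj₂-∑⊞ : ∀ {k} (F : Fin k → ExpQ G) → proj₂ (∑⊞ F) ≡ ℚΣ.sum (proj₂ ∘ F)
    proj₂-∑⊞ {zero}  F = refl
    proj₂-∑⊞ {suc k} F = cong (proj₂ (F zero) +_) (proj₂-∑⊞ (F ∘ suc))

    cone-box : ∀ (α : Fin n → ℚ) β → (∀ i → 0ℚ ≤ α i) → ℚΣ.sum α ≤ β → Cone G (tabulate α , β)
    cone-box α β 0≤α ∑α≤β =
      subst (Cone G) box≡ (cone-⊞ (cone-∑⊞ F∈cone) (cone-generator (p≤q⇒0≤q-p ∑α≤β) tvar))
      where
      open ≡-Reasoning
      Σα : ℚ
      Σα = ℚΣ.sum α
      F : Fin n → ExpQ G
      F i = α i ⊛ embed G (e i , 1)
      F∈cone : ∀ i → Cone G (F i)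
      F∈cone i = cone-generator (0≤α i) (var i)
      T : ExpQ G
      T = (β - Σα) ⊛ embed G (𝟎 , 1)
      coordinate : ∀ j → lookup (proj₁ (∑⊞ F ⊞ T)) j ≡ lookup (tabulate α) j
      coordinate j = begin
        lookup (proj₁ (∑⊞ F ⊞ T)) j
          ≡⟨ lookup-⊞ (∑⊞ F) T j ⟩
        lookup (proj₁ (∑⊞ F)) j + lookup (proj₁ T) j
          ≡⟨ cong₂ _+_ (lookup-∑⊞ F j) (lookup-⊛-embed (β - Σα) (𝟎 , 1) j) ⟩
        ℚΣ.sum (λ i → lookup (proj₁ (F i)) j) + (β - Σα) * fromℕ (lookup 𝟎 j)
          ≡⟨ cong₂ _+_ (ℚΣ.sum-cong-≗ (λ i → lookup-⊛-embed (α i) (e i , 1) j))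
                       (cong (λ x → (β - Σα) * fromℕ x) (Vec.lookup-replicate j 0)) ⟩
        ℚΣ.sum (λ i → α i * fromℕ (lookup (e i) j)) + (β - Σα) * 0ℚ
          ≡⟨ cong₂ _+_ (∑-δ α j) (ℚP.*-zeroʳ (β - Σα)) ⟩
        α j + 0ℚ
          ≡⟨ ℚP.+-identityʳ (α j) ⟩
        α j
          ≡⟨ Vec.lookup∘tabulate α j ⟨
        lookup (tabulate α) j ∎
      height : proj₂ (∑⊞ F ⊞ T) ≡ β
      height = begin
        proj₂ (∑⊞ F) + (β - Σα) * 1ℚ
          ≡⟨ cong (_+ (β - Σα) * 1ℚ) (trans (proj₂-∑⊞ F) (ℚΣ.sum-cong-≗ (ℚP.*-identityʳ ∘ α))) ⟩
        Σα + (β - Σα) * 1ℚ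
          ≡⟨ cancel Σα β ⟩
        β ∎
        where
        cancel : ∀ s b → s + (b - s) * 1ℚ ≡ b
        cancel = solve 2 (λ s b → s :+ (b :- s) :* con 1ℚ := b) refl
      box≡ : ∑⊞ F ⊞ T ≡ (tabulate α , β)
      box≡ = cong₂ _,_ (vec-ext coordinate) height

    interior⇒cone : ∀ {P} → Interior G P → Cone G P
    interior⇒cone {P} (ε , ε>0 , ball) =
      ball (proj₁ P) (proj₂ P) (λ i → centre (lookup (proj₁ P) i)) (centre (proj₂ P))
      where
      centre : ∀ x → ∣ x - x ∣ < ε
      centre x = subst (_< ε) (sym (cong ∣_∣ (ℚP.+-inverseʳ x))) ε>0

    interior-criterion : ∀ {Y ε} (ζ : Exp n) → Cone G Y → 0ℚ < ε →
      (∀ i → 0 ℕ.< lookup (proj₁ ζ) i) → ℕΣ.sum (λ i → suc (lookup (proj₁ ζ) i)) ℕ.< proj₂ ζ →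
      Interior G (Y ⊞ ε ⊛ embed G ζ)
    interior-criterion {Y} {ε} ζ Y∈cone ε>0 ζ>0 slack = ε , ε>0 , ball
      where
      instance
        ε-nonNeg : NonNegative ε
        ε-nonNeg = nonNegative (ℚP.<⇒≤ ε>0)
      P : ExpQ G
      P = Y ⊞ ε ⊛ embed G ζ
      z : Fin n → ℕ
      z = lookup (proj₁ ζ)
      add-sub : ∀ x y → x + (y - x) ≡ y
      add-sub = solve 2 (λ x y → x :+ (y :- x) := y) refl
      ε-suc : ∀ m → ε * fromℕ (suc m) ≡ ε * fromℕ m + ε
      ε-suc m = trans (cong (ε *_) (fromℕ-suc m)) (distrib ε (fromℕ m))
        where
        distrib : ∀ r x → r * (1ℚ + x) ≡ r * x + r
        distrib = solve 2 (λ r x → r :* (con 1ℚ :+ x) := r :* x :+ r) refl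
      lookup-P : ∀ i → lookup (proj₁ P) i ≡ lookup (proj₁ Y) i + ε * fromℕ (z i)
      lookup-P i = trans (lookup-⊞ Y (ε ⊛ embed G ζ) i) (cong (lookup (proj₁ Y) i +_) (lookup-⊛-embed ε ζ i))
      ball : ∀ q b → (∀ i → ∣ lookup q i - lookup (proj₁ P) i ∣ < ε) → ∣ b - proj₂ P ∣ < ε → Cone G (q , b)
      ball q b q≈P b≈P = subst (Cone G) Y⊞box≡qb (cone-⊞ Y∈cone (cone-box α β 0≤α ∑α≤β))
        where
        open ℚP.≤-Reasoning
        α : Fin n → ℚ
        α i = lookup q i - lookup (proj₁ Y) i
        β : ℚ
        β = b - proj₂ Y
        α≡ : ∀ i → α i ≡ ε * fromℕ (z i) + (lookup q i - lookup (proj₁ P) i)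
        α≡ i = begin-equality
          lookup q i - lookup (proj₁ Y) i
            ≡⟨ shift (lookup q i) (lookup (proj₁ Y) i) (ε * fromℕ (z i)) ⟩
          ε * fromℕ (z i) + (lookup q i - (lookup (proj₁ Y) i + ε * fromℕ (z i)))
            ≡⟨ cong (λ p → ε * fromℕ (z i) + (lookup q i - p)) (lookup-P i) ⟨
          ε * fromℕ (z i) + (lookup q i - lookup (proj₁ P) i) ∎
          where
          shift : ∀ x y t → x - y ≡ t + (x - (y + t))
          shift = solve 3 (λ x y t → x :- y := t :+ (x :- (y :+ t))) refl
        0≤α : ∀ i → 0ℚ ≤ α i
        0≤α i = begin
          0ℚ
            ≡⟨ cancel ε ⟨
          ε * 1ℚ + - ε
            ≤⟨ ℚP.+-mono-≤ (ℚP.*-monoˡ-≤-nonNeg ε (fromℕ-mono-≤ (ζ>0 i))) (∣p∣<q⇒-q≤p (q≈P i)) ⟩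
          ε * fromℕ (z i) + (lookup q i - lookup (proj₁ P) i)
            ≡⟨ α≡ i ⟨
          α i ∎
          where
          cancel : ∀ x → x * 1ℚ + - x ≡ 0ℚ
          cancel = solve 1 (λ x → x :* con 1ℚ :+ :- x := con 0ℚ) refl
        α≤ : ∀ i → α i ≤ ε * fromℕ (suc (z i))
        α≤ i = begin
          α i
            ≡⟨ α≡ i ⟩
          ε * fromℕ (z i) + (lookup q i - lookup (proj₁ P) i)
            ≤⟨ ℚP.+-monoʳ-≤ (ε * fromℕ (z i)) (∣p∣<q⇒p≤q (q≈P i)) ⟩
          ε * fromℕ (z i) + ε
            ≡⟨ ε-suc (z i) ⟨
          ε * fromℕ (suc (z i)) ∎
        S : ℕ
        S = ℕΣ.sum (suc ∘ z)
        ∑α≤β : ℚΣ.sum α ≤ β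
        ∑α≤β = begin
          ℚΣ.sum α                               ≤⟨ ℚsum-mono-≤ α≤ ⟩
          ℚΣ.sum (λ i → ε * fromℕ (suc (z i)))   ≡⟨ ℚΣ.*-distribˡ-sum ε (fromℕ ∘ suc ∘ z) ⟨
          ε * ℚΣ.sum (fromℕ ∘ suc ∘ z)           ≡⟨ cong (ε *_) (fromℕ-sum (suc ∘ z)) ⟨
          ε * fromℕ S                            ≡⟨ add-neg (ε * fromℕ S) ε ⟨
          (ε * fromℕ S + ε) + - ε                ≡⟨ cong (_+ - ε) (ε-suc S) ⟨
          ε * fromℕ (suc S) + - ε
            ≤⟨ ℚP.+-mono-≤ (ℚP.*-monoˡ-≤-nonNeg ε (fromℕ-mono-≤ slack)) (∣p∣<q⇒-q≤p b≈P) ⟩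
          ε * fromℕ (proj₂ ζ) + (b - proj₂ P)    ≡⟨ regroup (ε * fromℕ (proj₂ ζ)) (proj₂ Y) b ⟩
          β                                      ∎
          where
          add-neg : ∀ x y → (x + y) + - y ≡ x
          add-neg = solve 2 (λ x y → (x :+ y) :+ :- y := x) refl
          regroup : ∀ x y b → x + (b - (y + x)) ≡ b - y
          regroup = solve 3 (λ x y b → x :+ (b :- (y :+ x)) := b :- y) refl
        Y⊞box≡qb : Y ⊞ (tabulate α , β) ≡ (q , b)
        Y⊞box≡qb = cong₂ _,_ (vec-ext coordinate) (add-sub (proj₂ Y) b)
          where
          coordinate : ∀ i → lookup (proj₁ (Y ⊞ (tabulate α , β))) i ≡ lookup q i
          coordinate i = trans (lookup-⊞ Y (tabulate α , β) i)
            (trans (cong (lookup (proj₁ Y) i +_) (Vec.lookup∘tabulate α i)) (add-sub (lookup (proj₁ Y) i) (lookup q i)))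

    -- With k = Σᵢ (wᵢ + 1) and d = 2k + 1 one has d·w = k·y + ζ for ζ = (w̃ , a + k),
    -- and ζ satisfies the slack condition of interior-criterion because a > 0.
    interior-if-2w-t∈ℕB : ∀ {y} (w : Exp n) → ℕB G y →
      (∀ i → lookup (proj₁ y) i ≡ lookup (proj₁ w) i ℕ.+ lookup (proj₁ w) i) →
      suc (proj₂ y) ≡ proj₂ w ℕ.+ proj₂ w →
      (∀ i → 0 ℕ.< lookup (proj₁ w) i) →
      Interior G (embed G w)
    interior-if-2w-t∈ℕB {y} w@(w̃ , a) y∈ℕB y≡2w 1+y≡2a w>0 =
      subst (Interior G) (sym w≡) (interior-criterion ζ (cone-⊛-ℕB 0≤c y∈ℕB) ε>0 w>0 k<a+k)
      where
      k d : ℕ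
      k = ℕΣ.sum (λ i → suc (lookup w̃ i))
      d = suc (2 ℕ.* k)
      instance
        d-positive : Positive (fromℕ d)
        d-positive = fromℕ-suc-positive (2 ℕ.* k)
        d-nonZero : NonZero (fromℕ d)
        d-nonZero = ℚP.pos⇒nonZero (fromℕ d)
      ε c : ℚ
      ε = 1/ fromℕ d
      c = ε * fromℕ k
      instance
        ε-nonNeg : NonNegative ε
        ε-nonNeg = ℚP.pos⇒nonNeg ε {{ℚP.1/pos⇒pos (fromℕ d)}}
        k-nonNeg : NonNegative (fromℕ k)
        k-nonNeg = nonNegative (fromℕ-nonNeg k)
      ε>0 : 0ℚ < ε
      ε>0 = ℚP.positive⁻¹ ε {{ℚP.1/pos⇒pos (fromℕ d)}}
      0≤c : 0ℚ ≤ c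
      0≤c = ℚP.nonNegative⁻¹ c {{ℚP.nonNeg*nonNeg⇒nonNeg ε (fromℕ k)}}
      ζ : Exp n
      ζ = w̃ , a ℕ.+ k
      k<a+k : k ℕ.< a ℕ.+ k
      k<a+k = ℕP.m<n+m k (half-of-suc-positive 1+y≡2a)
        where
        half-of-suc-positive : ∀ {t x} → suc t ≡ x ℕ.+ x → 0 ℕ.< x
        half-of-suc-positive {x = suc _} _ = ℕ.s≤s ℕ.z≤n
      scale : ∀ {x u v} → d ℕ.* x ≡ k ℕ.* u ℕ.+ v → fromℕ x ≡ c * fromℕ u + ε * fromℕ v
      scale {x} {u} {v} dx≡ku+v = begin
        fromℕ x                              ≡⟨ ℚP.*-identityˡ (fromℕ x) ⟨
        1ℚ * fromℕ x                         ≡⟨ cong (_* fromℕ x) (ℚP.*-inverseˡ (fromℕ d)) ⟨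
        (ε * fromℕ d) * fromℕ x              ≡⟨ ℚP.*-assoc ε (fromℕ d) (fromℕ x) ⟩
        ε * (fromℕ d * fromℕ x)              ≡⟨ cong (ε *_) (fromℕ-* d x) ⟨
        ε * fromℕ (d ℕ.* x)                  ≡⟨ cong (λ t → ε * fromℕ t) dx≡ku+v ⟩
        ε * fromℕ (k ℕ.* u ℕ.+ v)
          ≡⟨ cong (ε *_) (trans (fromℕ-+ (k ℕ.* u) v) (cong (_+ fromℕ v) (fromℕ-* k u))) ⟩
        ε * (fromℕ k * fromℕ u + fromℕ v)    ≡⟨ distrib ε (fromℕ k) (fromℕ u) (fromℕ v) ⟩
        c * fromℕ u + ε * fromℕ v            ∎
        where
        open ≡-Reasoning
        distrib : ∀ r K U V → r * (K * U + V) ≡ (r * K) * U + r * V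
        distrib = solve 4 (λ r K U V → r :* (K :* U :+ V) := (r :* K) :* U :+ r :* V) refl
      double : ∀ k x → suc (2 ℕ.* k) ℕ.* x ≡ k ℕ.* (x ℕ.+ x) ℕ.+ x
      double = solve-∀
      coordinate-scales : ∀ i → d ℕ.* lookup w̃ i ≡ k ℕ.* lookup (proj₁ y) i ℕ.+ lookup w̃ i
      coordinate-scales i = trans (double k (lookup w̃ i)) (cong (λ t → k ℕ.* t ℕ.+ lookup w̃ i) (sym (y≡2w i)))
      height-scales : d ℕ.* a ≡ k ℕ.* proj₂ y ℕ.+ (a ℕ.+ k)
      height-scales = begin
        d ℕ.* a                       ≡⟨ double k a ⟩
        k ℕ.* (a ℕ.+ a) ℕ.+ a         ≡⟨ cong (λ t → k ℕ.* t ℕ.+ a) 1+y≡2a ⟨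
        k ℕ.* suc (proj₂ y) ℕ.+ a     ≡⟨ unfold k (proj₂ y) a ⟩
        k ℕ.* proj₂ y ℕ.+ (a ℕ.+ k)   ∎
        where
        open ≡-Reasoning
        unfold : ∀ k t a → k ℕ.* suc t ℕ.+ a ≡ k ℕ.* t ℕ.+ (a ℕ.+ k)
        unfold = solve-∀
      w≡ : embed G w ≡ c ⊛ embed G y ⊞ ε ⊛ embed G ζ
      w≡ = cong₂ _,_ (vec-ext coordinate) (scale height-scales)
        where
        coordinate : ∀ i → lookup (proj₁ (embed G w)) i ≡ lookup (proj₁ (c ⊛ embed G y ⊞ ε ⊛ embed G ζ)) i
        coordinate i = begin
          lookup (proj₁ (embed G w)) i
            ≡⟨ Vec.lookup-map i fromℕ w̃ ⟩
          fromℕ (lookup w̃ i)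
            ≡⟨ scale (coordinate-scales i) ⟩
          c * fromℕ (lookup (proj₁ y) i) + ε * fromℕ (lookup w̃ i)
            ≡⟨ cong₂ _+_ (lookup-⊛-embed c y i) (lookup-⊛-embed ε ζ i) ⟨
          lookup (proj₁ (c ⊛ embed G y)) i + lookup (proj₁ (ε ⊛ embed G ζ)) i
            ≡⟨ lookup-⊞ (c ⊛ embed G y) (ε ⊛ embed G ζ) i ⟨
          lookup (proj₁ (c ⊛ embed G y ⊞ ε ⊛ embed G ζ)) i ∎
          where open ≡-Reasoning

open import Data.Nat using (_+_; _*_; _≤_; _<_; z≤n; s≤s)

+-tight : ∀ {a b c d} → a ≤ c → b ≤ d → a + b ≡ c + d → a ≡ c × b ≡ d
+-tight {a} {b} {c} {d} a≤c b≤d a+b≡c+d =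
  a≡c , ℕP.+-cancelˡ-≡ c b d (subst (λ x → x + b ≡ c + d) a≡c a+b≡c+d)
  where
  c≤a : c ≤ a
  c≤a = ℕP.+-cancelʳ-≤ d c a (subst (_≤ a + d) a+b≡c+d (ℕP.+-monoʳ-≤ a b≤d))
  a≡c : a ≡ c
  a≡c = ℕP.≤-antisym a≤c c≤a

sum-positive : ∀ {k} (f : Fin k → ℕ) → 0 < ℕΣ.sum f → ∃[ i ] 0 < f i
sum-positive {suc k} f ∑f>0 with f zero in f₀≡
... | suc _ = zero , subst (0 <_) (sym f₀≡) (s≤s z≤n)
... | zero  = let (i , fᵢ>0) = sum-positive (f ∘ suc) ∑f>0 in suc i , fᵢ>0

next-inject₁ : ∀ {k} (i : Fin k) → next (inject₁ i) ≡ suc i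
next-inject₁ {k} i = FinP.toℕ-injective (begin
  toℕ (next (inject₁ i))          ≡⟨ FinP.toℕ-fromℕ< _ ⟩
  suc (toℕ (inject₁ i)) % suc k   ≡⟨ cong (λ t → suc t % suc k) (FinP.toℕ-inject₁ i) ⟩
  suc (toℕ i) % suc k             ≡⟨ m<n⇒m%n≡m (s≤s (FinP.toℕ<n i)) ⟩
  suc (toℕ i)                     ∎)
  where open ≡-Reasoning

next-fromℕ : ∀ k → next (Fin.fromℕ k) ≡ zero
next-fromℕ k = FinP.toℕ-injective (begin
  toℕ (next (Fin.fromℕ k))          ≡⟨ FinP.toℕ-fromℕ< _ ⟩
  suc (toℕ (Fin.fromℕ k)) % suc k   ≡⟨ cong (λ t → suc t % suc k) (FinP.toℕ-fromℕ k) ⟩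
  suc k % suc k                     ≡⟨ n%n≡0 (suc k) ⟩
  0                                 ∎)
  where open ≡-Reasoning

sum-∘-next : ∀ {k} (f : Fin k → ℕ) → ℕΣ.sum (f ∘ next) ≡ ℕΣ.sum f
sum-∘-next {zero}  f = refl
sum-∘-next {suc k} f = begin
  ℕΣ.sum (f ∘ next)
    ≡⟨ ℕΣ.sum-init-last (f ∘ next) ⟩
  ℕΣ.sum (f ∘ next ∘ inject₁) + f (next (Fin.fromℕ k))
    ≡⟨ cong₂ _+_ (ℕΣ.sum-cong-≗ (cong f ∘ next-inject₁)) (cong f (next-fromℕ k)) ⟩
  ℕΣ.sum (f ∘ suc) + f zero
    ≡⟨ ℕP.+-comm (ℕΣ.sum (f ∘ suc)) (f zero) ⟩
  ℕΣ.sum f ∎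
  where open ≡-Reasoning

module _ {m : ℕ} where

  lookup-+ᵥ : ∀ (u v : Vec ℕ m) i → lookup (u +ᵥ v) i ≡ lookup u i + lookup v i
  lookup-+ᵥ u v i = Vec.lookup-zipWith _+_ i u v

  lookup-+ᵥ-positiveˡ : ∀ (u v : Vec ℕ m) {i} → 0 < lookup u i → 0 < lookup (u +ᵥ v) i
  lookup-+ᵥ-positiveˡ u v {i} uᵢ>0 = subst (0 <_) (sym (lookup-+ᵥ u v i)) (ℕP.≤-trans uᵢ>0 (ℕP.m≤m+n _ _))

  lookup-+ᵥ-positiveʳ : ∀ (u v : Vec ℕ m) {i} → 0 < lookup v i → 0 < lookup (u +ᵥ v) i
  lookup-+ᵥ-positiveʳ u v {i} vᵢ>0 = subst (0 <_) (sym (lookup-+ᵥ u v i)) (ℕP.≤-trans vᵢ>0 (ℕP.m≤n+m _ _))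

  +ᵥ-identityˡ : ∀ (u : Vec ℕ m) → 𝟎 +ᵥ u ≡ u
  +ᵥ-identityˡ = Vec.zipWith-identityˡ ℕP.+-identityˡ

  +ᵥ-identityʳ : ∀ (u : Vec ℕ m) → u +ᵥ 𝟎 ≡ u
  +ᵥ-identityʳ = Vec.zipWith-identityʳ ℕP.+-identityʳ

  +ᵥ-assoc : ∀ (u v w : Vec ℕ m) → (u +ᵥ v) +ᵥ w ≡ u +ᵥ (v +ᵥ w)
  +ᵥ-assoc = Vec.zipWith-assoc ℕP.+-assoc

  +ᵥ-cancelˡ : ∀ (u : Vec ℕ m) {v w} → u +ᵥ v ≡ u +ᵥ w → v ≡ w
  +ᵥ-cancelˡ u {v} {w} u+v≡u+w = vec-ext λ i → ℕP.+-cancelˡ-≡ (lookup u i) _ _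
    (trans (sym (lookup-+ᵥ u v i)) (trans (cong (λ x → lookup x i) u+v≡u+w) (lookup-+ᵥ u w i)))

  ⊕-identityˡ : ∀ (u : Exp m) → (𝟎 , 0) ⊕ u ≡ u
  ⊕-identityˡ (ũ , a) = cong (_, a) (+ᵥ-identityˡ ũ)

  ⊕-identityʳ : ∀ (u : Exp m) → u ⊕ (𝟎 , 0) ≡ u
  ⊕-identityʳ (ũ , a) = cong₂ _,_ (+ᵥ-identityʳ ũ) (ℕP.+-identityʳ a)

  ⊕-assoc : ∀ (u v w : Exp m) → (u ⊕ v) ⊕ w ≡ u ⊕ (v ⊕ w)
  ⊕-assoc (ũ , a) (ṽ , b) (w̃ , c) = cong₂ _,_ (+ᵥ-assoc ũ ṽ w̃) (ℕP.+-assoc a b c)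

  ⊕-cancelˡ : ∀ (u : Exp m) {v w} → u ⊕ v ≡ u ⊕ w → v ≡ w
  ⊕-cancelˡ (ũ , a) u+v≡u+w =
    cong₂ _,_ (+ᵥ-cancelˡ ũ (cong proj₁ u+v≡u+w)) (ℕP.+-cancelˡ-≡ a _ _ (cong proj₂ u+v≡u+w))

  0<lookup-e-same : ∀ (i : Fin m) → 0 < lookup (e i) i
  0<lookup-e-same i = ℕP.≤-reflexive (sym (Vec.lookup∘update i (replicate m 0) 1))

  lookup-e-other : ∀ {i j : Fin m} → i ≢ j → lookup (e i) j ≡ 0
  lookup-e-other {i} {j} i≢j = trans (Vec.lookup∘update′ (i≢j ∘ sym) (replicate m 0) 1) (Vec.lookup-replicate j 0)

  lookup-e-positive : ∀ {i j : Fin m} → 0 < lookup (e i) j → i ≡ j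
  lookup-e-positive {i} {j} eᵢⱼ>0 with i Fin.≟ j
  ... | yes i≡j = i≡j
  ... | no  i≢j = contradiction (subst (0 <_) (lookup-e-other i≢j) eᵢⱼ>0) ℕP.n≮0

  lookup-vsum : ∀ {k} (g : Fin k → Vec ℕ m) j →
    lookup (vsum (List.tabulate g)) j ≡ ℕΣ.sum (λ i → lookup (g i) j)
  lookup-vsum {zero}  g j = Vec.lookup-replicate j 0
  lookup-vsum {suc k} g j = trans (lookup-+ᵥ (g zero) _ j) (cong (lookup (g zero) j +_) (lookup-vsum (g ∘ suc) j))

  deg : Vec ℕ m → ℕ
  deg v = ℕΣ.sum (lookup v)

  deg-+ᵥ : ∀ (u v : Vec ℕ m) → deg (u +ᵥ v) ≡ deg u + deg v
  deg-+ᵥ u v = trans (ℕΣ.sum-cong-≗ (lookup-+ᵥ u v)) (ℕΣ.∑-distrib-+ (lookup u) (lookup v))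

  deg-𝟎 : deg 𝟎 ≡ 0
  deg-𝟎 = trans (ℕΣ.sum-cong-≗ {m} (λ i → Vec.lookup-replicate i 0)) (ℕΣ.sum-replicate-zero m)

  Tight : Exp m → Set
  Tight p = deg (proj₁ p) ≡ 2 * proj₂ p

deg-e : ∀ {m} (i : Fin m) → deg (e i) ≡ 1
deg-e {suc m} zero    = cong suc (deg-𝟎 {m})
deg-e {suc m} (suc i) = deg-e i

deg-vsum-e : ∀ {m k} (f : Fin k → Fin m) → deg (vsum (List.tabulate (e ∘ f))) ≡ k
deg-vsum-e {m} {zero}  f = deg-𝟎 {m}
deg-vsum-e {m} {suc k} f = trans (deg-+ᵥ (e (f zero)) _) (cong₂ _+_ (deg-e (f zero)) (deg-vsum-e (f ∘ suc)))

module _ {n : ℕ} (G : SimpleGraph n) where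
  open SimpleGraph G using (Adj)

  ℕB-⊕ : ∀ {u v} → ℕB G u → ℕB G v → ℕB G (u ⊕ v)
  ℕB-⊕ {u} u∈ℕB nil                       = subst (ℕB G) (sym (⊕-identityʳ u)) u∈ℕB
  ℕB-⊕ {u} u∈ℕB (cons {v} {g} v∈ℕB g∈B) = subst (ℕB G) (⊕-assoc u v g) (cons (ℕB-⊕ u∈ℕB v∈ℕB) g∈B)

  ℕB-generator : ∀ {g} → Gen G g → ℕB G g
  ℕB-generator {g} g∈B = subst (ℕB G) (⊕-identityˡ g) (cons nil g∈B)

  ℕB-tᵐ : ∀ m → ℕB G (𝟎 , m)
  ℕB-tᵐ zero    = nil
  ℕB-tᵐ (suc m) = subst (λ v → ℕB G (v , suc m)) (+ᵥ-identityˡ 𝟎) (ℕB-⊕ (ℕB-generator tvar) (ℕB-tᵐ m))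

  ℕB-vsum : ∀ {k} (g : Fin k → Vec ℕ n) → (∀ i → Gen G (g i , 1)) → ℕB G (vsum (List.tabulate g) , k)
  ℕB-vsum {zero}  g g∈B = nil
  ℕB-vsum {suc k} g g∈B = ℕB-⊕ (ℕB-generator (g∈B zero)) (ℕB-vsum (g ∘ suc) (g∈B ∘ suc))

  deg-generator : ∀ {g} → Gen G g → deg (proj₁ g) ≤ 2 * proj₂ g
  deg-generator (var i)      = ℕP.≤-trans (ℕP.≤-reflexive (deg-e i)) (s≤s z≤n)
  deg-generator (edge i j _) = ℕP.≤-reflexive (trans (deg-+ᵥ (e i) (e j)) (cong₂ _+_ (deg-e i) (deg-e j)))
  deg-generator tvar         = ℕP.≤-trans (ℕP.≤-reflexive (deg-𝟎 {n})) z≤n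

  deg-ℕB : ∀ {p} → ℕB G p → deg (proj₁ p) ≤ 2 * proj₂ p
  deg-ℕB nil = ℕP.≤-reflexive (deg-𝟎 {n})
  deg-ℕB (cons {u} {g} u∈ℕB g∈B) = begin
    deg (proj₁ u +ᵥ proj₁ g)        ≡⟨ deg-+ᵥ (proj₁ u) (proj₁ g) ⟩
    deg (proj₁ u) + deg (proj₁ g)   ≤⟨ ℕP.+-mono-≤ (deg-ℕB u∈ℕB) (deg-generator g∈B) ⟩
    2 * proj₂ u + 2 * proj₂ g       ≡⟨ ℕP.*-distribˡ-+ 2 (proj₂ u) (proj₂ g) ⟨
    2 * (proj₂ u + proj₂ g)         ∎
    where open ℕP.≤-Reasoning

  tight-split : ∀ {u g} → ℕB G u → Gen G g → Tight (u ⊕ g) → Tight u × Tight g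
  tight-split {u} {g} u∈ℕB g∈B tight = +-tight (deg-ℕB u∈ℕB) (deg-generator g∈B) (begin
    deg (proj₁ u) + deg (proj₁ g)   ≡⟨ deg-+ᵥ (proj₁ u) (proj₁ g) ⟨
    deg (proj₁ u +ᵥ proj₁ g)        ≡⟨ tight ⟩
    2 * (proj₂ u + proj₂ g)         ≡⟨ ℕP.*-distribˡ-+ 2 (proj₂ u) (proj₂ g) ⟩
    2 * proj₂ u + 2 * proj₂ g       ∎)
    where open ≡-Reasoning

  tight-neighbour : ∀ {p} → ℕB G p → Tight p → ∀ {j} → 0 < lookup (proj₁ p) j →
    ∃[ l ] Adj j l × 0 < lookup (proj₁ p) l
  tight-neighbour nil _ {j} pⱼ>0 = contradiction (subst (0 <_) (Vec.lookup-replicate j 0) pⱼ>0) ℕP.n≮0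
  tight-neighbour (cons u∈ℕB (var i)) tight _ =
    contradiction (trans (sym (deg-e i)) (proj₂ (tight-split u∈ℕB (var i) tight))) λ ()
  tight-neighbour (cons u∈ℕB tvar) tight _ =
    contradiction (trans (sym (deg-𝟎 {n})) (proj₂ (tight-split u∈ℕB tvar tight))) λ ()
  tight-neighbour (cons {u} u∈ℕB (edge i i′ i~i′)) tight {j} pⱼ>0 with j Fin.≟ i | j Fin.≟ i′
  ... | yes refl | _        =
    i′ , i~i′ , lookup-+ᵥ-positiveʳ (proj₁ u) _ (lookup-+ᵥ-positiveʳ (e i) (e i′) (0<lookup-e-same i′))
  ... | no _     | yes refl =
    i , SimpleGraph.sym G i~i′ , lookup-+ᵥ-positiveʳ (proj₁ u) _ (lookup-+ᵥ-positiveˡ (e i) (e i′) (0<lookup-e-same i))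
  ... | no j≢i   | no j≢i′  =
    let (l , j~l , uₗ>0) = tight-neighbour u∈ℕB u-tight uⱼ>0 in l , j~l , lookup-+ᵥ-positiveˡ (proj₁ u) _ uₗ>0
    where
    u-tight : Tight u
    u-tight = proj₁ (tight-split u∈ℕB (edge i i′ i~i′) tight)
    edge-misses-j : lookup (e i +ᵥ e i′) j ≡ 0
    edge-misses-j = trans (lookup-+ᵥ (e i) (e i′) j)
      (cong₂ _+_ (lookup-e-other (j≢i ∘ sym)) (lookup-e-other (j≢i′ ∘ sym)))
    uⱼ>0 : 0 < lookup (proj₁ u) j
    uⱼ>0 = subst (0 <_) (trans (lookup-+ᵥ (proj₁ u) _ j)
      (trans (cong (lookup (proj₁ u) j +_) edge-misses-j) (ℕP.+-identityʳ _))) pⱼ>0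

module _ {n : ℕ} {G : SimpleGraph n} {k : ℕ} (C : Cycle G k) where
  open Cycle C using (vtx; adj)

  𝟏[C]≡vsum : 𝟏[ C ] ≡ vsum (List.tabulate (e ∘ vtx))
  𝟏[C]≡vsum = cong vsum (List.map-tabulate id (e ∘ vtx))

  lookup-𝟏[C] : ∀ j → lookup 𝟏[ C ] j ≡ ℕΣ.sum (λ i → lookup (e (vtx i)) j)
  lookup-𝟏[C] j = trans (cong (λ v → lookup v j) 𝟏[C]≡vsum) (lookup-vsum (e ∘ vtx) j)

  deg-𝟏[C] : deg 𝟏[ C ] ≡ k
  deg-𝟏[C] = trans (cong deg 𝟏[C]≡vsum) (deg-vsum-e vtx)

  ℕB-𝟏[C] : ℕB G (𝟏[ C ] , k)
  ℕB-𝟏[C] = subst (λ v → ℕB G (v , k)) (sym 𝟏[C]≡vsum) (ℕB-vsum G (e ∘ vtx) (var ∘ vtx))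

  ℕB-2𝟏[C] : ℕB G (𝟏[ C ] +ᵥ 𝟏[ C ] , k)
  ℕB-2𝟏[C] = subst (λ v → ℕB G (v , k)) (vec-ext coordinate) (ℕB-vsum G edge-vector (λ i → edge _ _ (adj i)))
    where
    edge-vector : Fin k → Vec ℕ n
    edge-vector i = e (vtx i) +ᵥ e (vtx (next i))
    coordinate : ∀ j → lookup (vsum (List.tabulate edge-vector)) j ≡ lookup (𝟏[ C ] +ᵥ 𝟏[ C ]) j
    coordinate j = begin
      lookup (vsum (List.tabulate edge-vector)) j
        ≡⟨ lookup-vsum edge-vector j ⟩
      ℕΣ.sum (λ i → lookup (edge-vector i) j)
        ≡⟨ ℕΣ.sum-cong-≗ (λ i → lookup-+ᵥ (e (vtx i)) (e (vtx (next i))) j) ⟩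
      ℕΣ.sum (λ i → f i + f (next i))
        ≡⟨ ℕΣ.∑-distrib-+ f (f ∘ next) ⟩
      ℕΣ.sum f + ℕΣ.sum (f ∘ next)
        ≡⟨ cong (ℕΣ.sum f +_) (sum-∘-next f) ⟩
      ℕΣ.sum f + ℕΣ.sum f
        ≡⟨ cong₂ _+_ (lookup-𝟏[C] j) (lookup-𝟏[C] j) ⟨
      lookup 𝟏[ C ] j + lookup 𝟏[ C ] j
        ≡⟨ lookup-+ᵥ 𝟏[ C ] 𝟏[ C ] j ⟨
      lookup (𝟏[ C ] +ᵥ 𝟏[ C ]) j ∎
      where
      open ≡-Reasoning
      f : Fin k → ℕ
      f i = lookup (e (vtx i)) j

  ∈V-of-positive : ∀ {l} → 0 < lookup 𝟏[ C ] l → l ∈V C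
  ∈V-of-positive {l} Cₗ>0 =
    let (i , eᵢₗ>0) = sum-positive _ (subst (0 <_) (lookup-𝟏[C] l) Cₗ>0) in i , lookup-e-positive eᵢₗ>0

module _ {n : ℕ} {G : SimpleGraph n} (normal : IsNormal G) {m : ℕ} (C : Cycle G (suc (2 * m))) where
  open SimpleGraph G using (Adj)

  shift-by-cycle∈ω : ∀ w′ → ℕB G w′ → (∀ i → 0 < lookup (proj₁ (w′ ⊕ (𝟏[ C ] , suc m))) i) →
    Inω G (w′ ⊕ (𝟏[ C ] , suc m))
  shift-by-cycle∈ω w′@(x̃ , t) w′∈ℕB w>0 = w , (𝟎 , 0) , (w∈ℕB , w°) , nil , sym (⊕-identityʳ w)
    where
    w y : Exp n
    w = w′ ⊕ (𝟏[ C ] , suc m)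
    y = (w′ ⊕ w′) ⊕ (𝟏[ C ] +ᵥ 𝟏[ C ] , suc (2 * m))
    y∈ℕB : ℕB G y
    y∈ℕB = ℕB-⊕ G (ℕB-⊕ G w′∈ℕB w′∈ℕB) (ℕB-2𝟏[C] C)
    y≡2w : ∀ i → lookup (proj₁ y) i ≡ lookup (proj₁ w) i + lookup (proj₁ w) i
    y≡2w i = begin
      lookup ((x̃ +ᵥ x̃) +ᵥ (𝟏[ C ] +ᵥ 𝟏[ C ])) i
        ≡⟨ lookup-+ᵥ (x̃ +ᵥ x̃) _ i ⟩
      lookup (x̃ +ᵥ x̃) i + lookup (𝟏[ C ] +ᵥ 𝟏[ C ]) i
        ≡⟨ cong₂ _+_ (lookup-+ᵥ x̃ x̃ i) (lookup-+ᵥ 𝟏[ C ] 𝟏[ C ] i) ⟩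
      (xᵢ + xᵢ) + (cᵢ + cᵢ)
        ≡⟨ interchange xᵢ cᵢ ⟩
      (xᵢ + cᵢ) + (xᵢ + cᵢ)
        ≡⟨ cong₂ _+_ (lookup-+ᵥ x̃ 𝟏[ C ] i) (lookup-+ᵥ x̃ 𝟏[ C ] i) ⟨
      lookup (proj₁ w) i + lookup (proj₁ w) i ∎
      where
      open ≡-Reasoning
      xᵢ cᵢ : ℕ
      xᵢ = lookup x̃ i
      cᵢ = lookup 𝟏[ C ] i
      interchange : ∀ x c → (x + x) + (c + c) ≡ (x + c) + (x + c)
      interchange = solve-∀
    1+y≡2w : suc (proj₂ y) ≡ proj₂ w + proj₂ w
    1+y≡2w = heights t m
      where
      heights : ∀ t m → suc ((t + t) + suc (2 * m)) ≡ (t + suc m) + (t + suc m)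
      heights = solve-∀
    w° : Interior G (embed G w)
    w° = interior-if-2w-t∈ℕB G w y∈ℕB y≡2w 1+y≡2w w>0
    w∈ℤB : ℤB G w
    w∈ℤB = w′ ⊕ (𝟏[ C ] , suc (2 * m)) , (𝟎 , m) , ℕB-⊕ G w′∈ℕB (ℕB-𝟏[C] C) , ℕB-tᵐ G m ,
           trans (⊕-assoc w′ (𝟏[ C ] , suc m) (𝟎 , m))
                 (cong (w′ ⊕_) (cong₂ _,_ (+ᵥ-identityʳ 𝟏[ C ]) (heights m)))
      where
      heights : ∀ m → suc m + m ≡ suc (2 * m)
      heights = solve-∀
    w∈ℕB : ℕB G w
    w∈ℕB = normal w w∈ℤB (interior⇒cone G w°)

  neighbour-on-cycle : ∀ b → ωPrincipal G b → ∀ j → ℕB G (𝟏 +ᵥ e j , b) → ∃[ l ] Adj j l × l ∈V C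
  neighbour-on-cycle b ω≡ j w′∈ℕB = l , j~l , ∈V-of-positive C Cₗ>0
    where
    w′ p : Exp n
    w′ = 𝟏 +ᵥ e j , b
    p = e j +ᵥ 𝟏[ C ] , suc m
    w>0 : ∀ i → 0 < lookup (proj₁ (w′ ⊕ (𝟏[ C ] , suc m))) i
    w>0 i = lookup-+ᵥ-positiveˡ (𝟏 +ᵥ e j) 𝟏[ C ]
      (lookup-+ᵥ-positiveˡ 𝟏 (e j) (ℕP.≤-reflexive (sym (Vec.lookup-replicate i 1))))
    w≡𝟏b⊕p : w′ ⊕ (𝟏[ C ] , suc m) ≡ (𝟏 , b) ⊕ p
    w≡𝟏b⊕p = cong (_, b + suc m) (+ᵥ-assoc 𝟏 (e j) 𝟏[ C ])
    p∈ℕB : ℕB G p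
    p∈ℕB =
      let (u , u∈ℕB , w≡𝟏b⊕u) =
            Equivalence.to (ω≡ (w′ ⊕ (𝟏[ C ] , suc m))) (shift-by-cycle∈ω w′ w′∈ℕB w>0)
      in subst (ℕB G) (⊕-cancelˡ (𝟏 , b) (trans (sym w≡𝟏b⊕u) w≡𝟏b⊕p)) u∈ℕB
    p-tight : Tight p
    p-tight = trans (deg-+ᵥ (e j) 𝟏[ C ]) (trans (cong₂ _+_ (deg-e j) (deg-𝟏[C] C)) (degrees m))
      where
      degrees : ∀ m → 1 + suc (2 * m) ≡ 2 * suc m
      degrees = solve-∀
    pⱼ>0 : 0 < lookup (proj₁ p) j
    pⱼ>0 = lookup-+ᵥ-positiveˡ (e j) 𝟏[ C ] (0<lookup-e-same j)
    neighbour : ∃[ l ] Adj j l × 0 < lookup (proj₁ p) l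
    neighbour = tight-neighbour G p∈ℕB p-tight pⱼ>0
    l : Fin n
    l = proj₁ neighbour
    j~l : Adj j l
    j~l = proj₁ (proj₂ neighbour)
    Cₗ>0 : 0 < lookup 𝟏[ C ] l
    Cₗ>0 = subst (0 <_) (trans (lookup-+ᵥ (e j) 𝟏[ C ] l) (cong (_+ lookup 𝟏[ C ] l) (lookup-e-other j≢l)))
      (proj₂ (proj₂ neighbour))
      where
      j≢l : j ≢ l
      j≢l j≡l = SimpleGraph.irrefl G (subst (Adj j) (sym j≡l) j~l)

proposition3p13 : ∀ {n} (G : SimpleGraph n) → Connected G → EdgesNonempty G → IsNormal G →
    ∀ (k m : ℕ) → k ≡ suc (2 * m) → (C : Cycle G k) →
    ((∀ w′ → ℕB G w′ →
        (∀ i → 0 < lookup (proj₁ (w′ ⊕ (𝟏[ C ] , suc m))) i) →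
        Inω G (w′ ⊕ (𝟏[ C ] , suc m))
        × (∀ b → ωPrincipal G b →
             ∃[ u ] ℕB G u × (w′ ⊕ (𝟏[ C ] , suc m) ≡ (𝟏 , b) ⊕ u)))
    × (∀ b → 2 * b ≡ suc n → ωPrincipal G b →
        ∀ j → ℕB G (𝟏 +ᵥ e j , b) →
        ∃[ l ] SimpleGraph.Adj G j l × (j ∈V C ⊎ l ∈V C)))
proposition3p13 G _ _ normal .(suc (2 * m)) m refl C =
    (λ w′ w′∈ℕB w>0 →
       let w∈ω = shift-by-cycle∈ω normal {m} C w′ w′∈ℕB w>0
       in  w∈ω , λ b ω≡ → Equivalence.to (ω≡ (w′ ⊕ (𝟏[ C ] , suc m))) w∈ω)
  , (λ b _ ω≡ j w′∈ℕB →
       let (l , j~l , l∈C) = neighbour-on-cycle normal {m} C b ω≡ j w′∈ℕB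
       in  l , j~l , inj₂ l∈C)
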